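{- Let $j,k,n,r$ be positive integers. There is a bijection from the set of $r$-colored permutations $\Sigma$ of $[n]$ with $\mathrm{cr}(\Sigma)<j$ and $\mathrm{ne}(\Sigma)<k$ to the set of pairs $(\Lambda^+,\Lambda^-)$ of $r$-colored matchings of $[2n]$, each with crossing number less than $j$ and nesting number less than $k$, such that (a) $\{1,3,5,\dots,2n-1\}$ is the disjoint union of $\min(\Lambda^+)\setminus\max(\Lambda^+)$ and $\max(\Lambda^-)\setminus\min(\Lambda^-)$; (b) $\{2,4,6,\dots,2n\}$ is the disjoint union of $\max(\Lambda^+)\setminus\min(\Lambda^+)$ and $\min(\Lambda^-)\setminus\max(\Lambda^-)$.
   Context: For a partition $P$ of $[m]=\{1,\dots,m\}$, $\mathrm{Arc}(P)$ is the set of pairs $(i,j)$ with $i,j$ in the same block and $j$ the least element of that block greater than $i$; $\min(P)$, $\max(P)$ are the sets of minimal and maximal elements of blocks. An $r$-colored matching is $\Lambda=(P,\varphi)$ with $\varphi:\mathrm{Arc}(P)\to[r]$ and all blocks of $P$ of size $\le2$; $\min(\Lambda)=\min(P)$, $\max(\Lambda)=\max(P)$; its crossing (nesting) number is the largest $k$ such that there are $k$ arcs of the same color with $i_1<\dots<i_k<j_1<\dots<j_k$ (resp. $i_1<\dots<i_k<j_k<\dots<j_1$). For a permutation $\sigma$ of $[n]$, let $A^+_\sigma=\{(i,\sigma(i)):i\le\sigma(i)\}$ and $A^-_\sigma=\{(\sigma(i),i):\sigma(i)<i\}$. An $r$-colored permutation is a triple $\Sigma=(\sigma,\varphi^+,\varphi^-)$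 with $\varphi^\pm:A^\pm_\sigma\to[r]$. $\Sigma$ has a $k$-crossing (resp. $k$-nesting) if either there are $k$ arcs $(i_t,j_t)$ in $A^+_\sigma$ all of the same $\varphi^+$-color with $i_1<\dots<i_k\le j_1<\dots<j_k$ (resp. $i_1<\dots<i_k\le j_k<\dots<j_1$), or there are $k$ arcs in $A^-_\sigma$ all of the same $\varphi^-$-color with $i_1<\dots<i_k<j_1<\dots<j_k$ (resp. $i_1<\dots<i_k<j_k<\dots<j_1$). $\mathrm{cr}(\Sigma)$, $\mathrm{ne}(\Sigma)$ are the largest such $k$. -}

module Defs where

open import Data.Nat as ℕ using (ℕ; _*_; _+_)
import Data.Nat.Properties as ℕP
open import Data.Fin as F using (Fin; toℕ)
open import Data.Fin.Permutation using (Permutation′; _⟨$⟩ʳ_)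
open import Data.Product using (Σ; ∃; _×_; _,_; proj₁; proj₂)
open import Data.Sum using (_⊎_)
open import Data.Empty using (⊥)
open import Relation.Nullary using (¬_)
open import Relation.Binary.PropositionalEquality
open import Relation.Binary.Bundles using (Setoid)
open import Relation.Binary.Structures using (IsEquivalence)

-- Conventions: [m] = {1,…,m} is modelled by Fin m, element i ∈ Fin m
-- standing for the integer toℕ i + 1.  Only the order matters for arcs.

Increasing : ∀ {k m} → (Fin k → Fin m) → Set
Increasing {k} x = ∀ (s t : Fin k) → s F.< t → x s F.< x t

Decreasing : ∀ {k m} → (Fin k → Fin m) → Set
Decreasing {k} x = ∀ (s t : Fin k) → s F.< t → x t F.< x s

-- x₁ < … < x_k  R  y₁ < … < y_k   (R between x_k and y₁; equivalently,
-- since the sequences are monotone, between every x_s and y_t)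
CrossShape : ∀ {k m} → (Fin m → Fin m → Set) → (Fin k → Fin m) → (Fin k → Fin m) → Set
CrossShape {k} R x y = Increasing x × Increasing y × (∀ (s t : Fin k) → R (x s) (y t))

-- x₁ < … < x_k  R  y_k < … < y₁   (R between x_k and y_k; equivalently
-- between every x_s and y_t)
NestShape : ∀ {k m} → (Fin m → Fin m → Set) → (Fin k → Fin m) → (Fin k → Fin m) → Set
NestShape {k} R x y = Increasing x × Decreasing y × (∀ (s t : Fin k) → R (x s) (y t))

record ColPerm (n r : ℕ) : Set where
  field
    σ  : Permutation′ n
    -- φ⁺ i _ : colour of the arc (i , σ i) ∈ A⁺_σ   (i ≤ σ i)
    φ⁺ : (i : Fin n) → i F.≤ σ ⟨$⟩ʳ i → Fin r
    -- φ⁻ i _ : colour of the arc (σ i , i) ∈ A⁻_σ   (σ i < i)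
    φ⁻ : (i : Fin n) → σ ⟨$⟩ʳ i F.< i → Fin r

module _ {n r : ℕ} (S : ColPerm n r) where
  open ColPerm S

  HasCrossing⁺ : ℕ → Set
  HasCrossing⁺ k = Σ (Fin k → Fin n) λ a → Σ ((t : Fin k) → a t F.≤ σ ⟨$⟩ʳ a t) λ p →
    (∃ λ c → ∀ t → φ⁺ (a t) (p t) ≡ c) × CrossShape F._≤_ a (λ t → σ ⟨$⟩ʳ a t)

  HasCrossing⁻ : ℕ → Set
  HasCrossing⁻ k = Σ (Fin k → Fin n) λ b → Σ ((t : Fin k) → σ ⟨$⟩ʳ b t F.< b t) λ p →
    (∃ λ c → ∀ t → φ⁻ (b t) (p t) ≡ c) × CrossShape F._<_ (λ t → σ ⟨$⟩ʳ b t) b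

  HasNesting⁺ : ℕ → Set
  HasNesting⁺ k = Σ (Fin k → Fin n) λ a → Σ ((t : Fin k) → a t F.≤ σ ⟨$⟩ʳ a t) λ p →
    (∃ λ c → ∀ t → φ⁺ (a t) (p t) ≡ c) × NestShape F._≤_ a (λ t → σ ⟨$⟩ʳ a t)

  HasNesting⁻ : ℕ → Set
  HasNesting⁻ k = Σ (Fin k → Fin n) λ b → Σ ((t : Fin k) → σ ⟨$⟩ʳ b t F.< b t) λ p →
    (∃ λ c → ∀ t → φ⁻ (b t) (p t) ≡ c) × NestShape F._<_ (λ t → σ ⟨$⟩ʳ b t) b

  HasCrossing : ℕ → Set
  HasCrossing k = HasCrossing⁺ k ⊎ HasCrossing⁻ k

  HasNesting : ℕ → Set
  HasNesting k = HasNesting⁺ k ⊎ HasNesting⁻ k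

crLess : ∀ {n r} → ColPerm n r → ℕ → Set
crLess S j = ∀ k → HasCrossing S k → k ℕ.< j

neLess : ∀ {n r} → ColPerm n r → ℕ → Set
neLess S j = ∀ k → HasNesting S k → k ℕ.< j

-- r-coloured matchings of [m]: a partition with blocks of size ≤ 2 is
-- encoded by the involution μ sending each element to the other element
-- of its block (fixing singletons).

record ColMatching (m r : ℕ) : Set where
  field
    μ     : Fin m → Fin m
    invol : ∀ i → μ (μ i) ≡ i
    φ     : (i : Fin m) → i F.< μ i → Fin r

module _ {m r : ℕ} (L : ColMatching m r) where
  open ColMatching L

  InMin : Fin m → Set
  InMin i = i F.≤ μ i

  InMax : Fin m → Set
  InMax i = μ i F.≤ i

  MHasCrossing : ℕ → Set
  MHasCrossing k = Σ (Fin k → Fin m) λ a → Σ ((t : Fin k) → a t F.< μ (a t)) λ p →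
    (∃ λ c → ∀ t → φ (a t) (p t) ≡ c) × CrossShape F._<_ a (λ t → μ (a t))

  MHasNesting : ℕ → Set
  MHasNesting k = Σ (Fin k → Fin m) λ a → Σ ((t : Fin k) → a t F.< μ (a t)) λ p →
    (∃ λ c → ∀ t → φ (a t) (p t) ≡ c) × NestShape F._<_ a (λ t → μ (a t))

mcrLess : ∀ {m r} → ColMatching m r → ℕ → Set
mcrLess L j = ∀ k → MHasCrossing L k → k ℕ.< j

mneLess : ∀ {m r} → ColMatching m r → ℕ → Set
mneLess L j = ∀ k → MHasNesting L k → k ℕ.< j

_∖_ : ∀ {m} → (Fin m → Set) → (Fin m → Set) → Fin m → Set
(A ∖ B) x = A x × ¬ B x

IsDisjointUnion : ∀ {m} → (Fin m → Set) → (Fin m → Set) → (Fin m → Set) → Set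
IsDisjointUnion S A B =
  (∀ x → S x → A x ⊎ B x) × (∀ x → A x ⊎ B x → S x) × (∀ x → A x → B x → ⊥)

-- element of {1,3,…,2n-1}  (0-based index 2q)
OddPos : ∀ {m} → Fin m → Set
OddPos i = ∃ λ q → toℕ i ≡ 2 * q

-- element of {2,4,…,2n}    (0-based index 2q+1)
EvenPos : ∀ {m} → Fin m → Set
EvenPos i = ∃ λ q → toℕ i ≡ 2 * q + 1

-- The two sets of the proposition, as setoids whose equality compares
-- only the underlying combinatorial data (not proofs).

CPSet : ℕ → ℕ → ℕ → ℕ → Set
CPSet j k n r = Σ (ColPerm n r) λ S → crLess S j × neLess S k

MPSet : ℕ → ℕ → ℕ → ℕ → Set
MPSet j k n r = Σ (ColMatching (2 * n) r × ColMatching (2 * n) r) λ where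
  (L⁺ , L⁻) → (mcrLess L⁺ j × mneLess L⁺ k) × (mcrLess L⁻ j × mneLess L⁻ k)
    × IsDisjointUnion OddPos (InMin L⁺ ∖ InMax L⁺) (InMax L⁻ ∖ InMin L⁻)
    × IsDisjointUnion EvenPos (InMax L⁺ ∖ InMin L⁺) (InMin L⁻ ∖ InMax L⁻)

_≈CP_ : ∀ {n r} → ColPerm n r → ColPerm n r → Set
S ≈CP T = (∀ i → S.σ ⟨$⟩ʳ i ≡ T.σ ⟨$⟩ʳ i)
        × (∀ i p q → S.φ⁺ i p ≡ T.φ⁺ i q)
        × (∀ i p q → S.φ⁻ i p ≡ T.φ⁻ i q)
  where module S = ColPerm S
        module T = ColPerm T

_≈CM_ : ∀ {m r} → ColMatching m r → ColMatching m r → Set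
L ≈CM M = (∀ i → L.μ i ≡ M.μ i) × (∀ i p q → L.φ i p ≡ M.φ i q)
  where module L = ColMatching L
        module M = ColMatching M

≈CP-isEquivalence : ∀ {n r} → IsEquivalence (_≈CP_ {n} {r})
≈CP-isEquivalence = record
  { refl  = λ {S} → (λ i → refl)
                  , (λ i p q → cong (ColPerm.φ⁺ S i) (ℕP.≤-irrelevant p q))
                  , (λ i p q → cong (ColPerm.φ⁻ S i) (ℕP.<-irrelevant p q))
  ; sym   = λ (e , f , g) → (λ i → sym (e i)) , (λ i p q → sym (f i q p)) , (λ i p q → sym (g i q p))
  ; trans = λ (e , f , g) (e' , f' , g') →
      (λ i → trans (e i) (e' i))
    , (λ i p q → trans (f i p (subst (λ z → i F.≤ z) (e i) p)) (f' i _ q))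
    , (λ i p q → trans (g i p (subst (λ z → z F.< i) (e i) p)) (g' i _ q))
  }

≈CM-isEquivalence : ∀ {m r} → IsEquivalence (_≈CM_ {m} {r})
≈CM-isEquivalence = record
  { refl  = λ {L} → (λ i → refl) , (λ i p q → cong (ColMatching.φ L i) (ℕP.<-irrelevant p q))
  ; sym   = λ (e , f) → (λ i → sym (e i)) , (λ i p q → sym (f i q p))
  ; trans = λ (e , f) (e' , f') →
      (λ i → trans (e i) (e' i))
    , (λ i p q → trans (f i p (subst (λ z → i F.< z) (e i) p)) (f' i _ q))
  }

module _ {n r : ℕ} where
  private
    module EP = IsEquivalence (≈CP-isEquivalence {n} {r})
    module EM = IsEquivalence (≈CM-isEquivalence {2 * n} {r})

  CPSetoid : ℕ → ℕ → Setoid _ _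
  CPSetoid j k = record
    { Carrier = CPSet j k n r
    ; _≈_ = λ x y → proj₁ x ≈CP proj₁ y
    ; isEquivalence = record
        { refl = λ {x} → EP.refl {proj₁ x}
        ; sym = λ {x} {y} → EP.sym {proj₁ x} {proj₁ y}
        ; trans = λ {x} {y} {z} → EP.trans {proj₁ x} {proj₁ y} {proj₁ z} } }

  MPSetoid : ℕ → ℕ → Setoid _ _
  MPSetoid j k = record
    { Carrier = MPSet j k n r
    ; _≈_ = λ x y → (proj₁ (proj₁ x) ≈CM proj₁ (proj₁ y)) × (proj₂ (proj₁ x) ≈CM proj₂ (proj₁ y))
    ; isEquivalence = record
        { refl = λ {x} → EM.refl {proj₁ (proj₁ x)} , EM.refl {proj₂ (proj₁ x)}
        ; sym = λ {x} {y} (a , b) → EM.sym {proj₁ (proj₁ x)} {proj₁ (proj₁ y)} a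
                                  , EM.sym {proj₂ (proj₁ x)} {proj₂ (proj₁ y)} b
        ; trans = λ {x} {y} {z} (a , b) (c , d) →
            EM.trans {proj₁ (proj₁ x)} {proj₁ (proj₁ y)} {proj₁ (proj₁ z)} a c
          , EM.trans {proj₂ (proj₁ x)} {proj₂ (proj₁ y)} {proj₂ (proj₁ z)} b d } }

-- Doubling i ∈ [n] into the positions 2i−1 < 2i of [2n], an arc (i, σ i) of A⁺ becomes the arc
-- (2i−1, 2σ(i)) of Λ⁺ and an arc (σ i, i) of A⁻ becomes the arc (2σ(i), 2i−1) of Λ⁻. Doubling is
-- strictly monotone on each copy of [n], and i ≤ j ⇔ 2i−1 < 2j, i < j ⇔ 2i < 2j−1, so a family of
-- arcs of one colour forms a k-crossing or k-nesting before doubling iff it does after. Conversely,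
-- (a) and (b) say that every odd position opens an arc of Λ⁺ or closes one of Λ⁻, and every even
-- position closes an arc of Λ⁺ or opens one of Λ⁻, never both; so the arcs of Λ⁺ and Λ⁻ together
-- match odd with even positions bijectively, and reading this matching on [n] recovers σ.
module Submission where

open import Defs
open import Data.Nat using (ℕ; _<_)
open import Function.Bundles using (Bijection)

open import Data.Bool using (if_then_else_)
open import Data.Empty using (⊥; ⊥-elim)
open import Data.Fin as F using (Fin; toℕ; fromℕ<)
import Data.Fin.Properties as FP
open import Data.Fin.Permutation using (Permutation′; _⟨$⟩ʳ_; _⟨$⟩ˡ_; inverseˡ; inverseʳ; permutation)
open import Data.Nat as ℕ using (zero; suc; _*_; s≤s; s<s; s≤s⁻¹; s<s⁻¹)
import Data.Nat.Properties as ℕP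
open import Data.Product using (Σ; ∃; _×_; _,_; proj₁; proj₂)
import Data.Product as Product
open import Data.Product.Function.NonDependent.Propositional using (_×-⇔_)
open import Data.Sum using (_⊎_; inj₁; inj₂; [_,_])
import Data.Sum as Sum
open import Function using (_∘_; flip)
open import Function.Bundles using (_⇔_; mk⇔; Equivalence; Inverse)
open import Function.Construct.Composition using (_⇔-∘_)
import Function.Properties.Equivalence as ⇔
open import Function.Properties.Inverse using (Inverse⇒Bijection)
open import Relation.Binary using (Decidable; tri<; tri≈; tri>)
open import Relation.Binary.Bundles using (Setoid)
open import Relation.Binary.PropositionalEquality using (_≡_; _≢_; refl; sym; trans; cong; subst; subst₂; _≗_)
open import Relation.Nullary using (¬_; yes; no; does)
open import Relation.Nullary.Decidable using (dec-true; dec-false)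

open Equivalence using (to; from)

module _ {n : ℕ} where

  -- left i and right i are the positions 2i−1 and 2i of [2n]. They are opaque so that unification
  -- never normalises the bound proofs hidden in fromℕ<.
  opaque
    left right : Fin n → Fin (2 * n)
    left i = fromℕ< (ℕP.*-monoʳ-< 2 (FP.toℕ<n i))
    right i = fromℕ< (subst (ℕ._≤ 2 * n) (ℕP.*-suc 2 (toℕ i)) (ℕP.*-monoʳ-≤ 2 (FP.toℕ<n i)))

    toℕ-left : ∀ i → toℕ (left i) ≡ 2 * toℕ i
    toℕ-left i = FP.toℕ-fromℕ< _

    toℕ-right : ∀ i → toℕ (right i) ≡ suc (2 * toℕ i)
    toℕ-right i = FP.toℕ-fromℕ< _

  left-injective : ∀ {i j} → left i ≡ left j → i ≡ j
  left-injective {i} {j} e = FP.toℕ-injective (ℕP.*-cancelˡ-≡ (toℕ i) (toℕ j) 2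
    (trans (sym (toℕ-left i)) (trans (cong toℕ e) (toℕ-left j))))

  right-injective : ∀ {i j} → right i ≡ right j → i ≡ j
  right-injective {i} {j} e = FP.toℕ-injective (ℕP.*-cancelˡ-≡ (toℕ i) (toℕ j) 2 (ℕP.suc-injective
    (trans (sym (toℕ-right i)) (trans (cong toℕ e) (toℕ-right j)))))

  left≢right : ∀ {i j} → left i ≢ right j
  left≢right {i} {j} e =
    ℕP.even≢odd (toℕ i) (toℕ j) (trans (sym (toℕ-left i)) (trans (cong toℕ e) (toℕ-right j)))

  private
    halve : ∀ m → ∃ λ h → m ≡ 2 * h ⊎ m ≡ suc (2 * h)
    halve zero = 0 , inj₁ refl
    halve (suc m) with halve m
    ... | h , inj₁ e = h , inj₂ (cong suc e)
    ... | h , inj₂ e = suc h , inj₁ (trans (cong suc e) (sym (ℕP.*-suc 2 h)))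

    toℕ-left-fromℕ< : ∀ {h} (h<n : h ℕ.< n) → toℕ (left (fromℕ< h<n)) ≡ 2 * h
    toℕ-left-fromℕ< h<n = trans (toℕ-left _) (cong (2 *_) (FP.toℕ-fromℕ< h<n))

    toℕ-right-fromℕ< : ∀ {h} (h<n : h ℕ.< n) → toℕ (right (fromℕ< h<n)) ≡ suc (2 * h)
    toℕ-right-fromℕ< h<n = trans (toℕ-right _) (cong (suc ∘ (2 *_)) (FP.toℕ-fromℕ< h<n))

  parity : ∀ q → (∃ λ (i : Fin n) → q ≡ left i) ⊎ (∃ λ (i : Fin n) → q ≡ right i)
  parity q with halve (toℕ q)
  ... | h , inj₁ e = inj₁ (fromℕ< h<n , FP.toℕ-injective (trans e (sym (toℕ-left-fromℕ< h<n))))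
    where h<n = ℕP.*-cancelˡ-< 2 h n (subst (ℕ._< 2 * n) e (FP.toℕ<n q))
  ... | h , inj₂ e = inj₂ (fromℕ< h<n , FP.toℕ-injective (trans e (sym (toℕ-right-fromℕ< h<n))))
    where h<n = ℕP.*-cancelˡ-< 2 h n (ℕP.<-trans (ℕP.n<1+n _) (subst (ℕ._< 2 * n) e (FP.toℕ<n q)))

  private
    <-via-toℕ : ∀ {p q : Fin (2 * n)} {a b} → toℕ p ≡ a → toℕ q ≡ b → p F.< q ⇔ a ℕ.< b
    <-via-toℕ refl refl = mk⇔ (λ lt → lt) (λ lt → lt)

  left<left⇔ : ∀ {i j} → left i F.< left j ⇔ i F.< j
  left<left⇔ {i} {j} =
    mk⇔ (ℕP.*-cancelˡ-< 2 _ _) (ℕP.*-monoʳ-< 2) ⇔-∘ <-via-toℕ (toℕ-left i) (toℕ-left j)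

  right<right⇔ : ∀ {i j} → right i F.< right j ⇔ i F.< j
  right<right⇔ {i} {j} =
    mk⇔ (ℕP.*-cancelˡ-< 2 _ _ ∘ s<s⁻¹) (s<s ∘ ℕP.*-monoʳ-< 2) ⇔-∘ <-via-toℕ (toℕ-right i) (toℕ-right j)

  left<right⇔ : ∀ {i j} → left i F.< right j ⇔ i F.≤ j
  left<right⇔ {i} {j} =
    mk⇔ (ℕP.*-cancelˡ-≤ 2 ∘ s≤s⁻¹) (s≤s ∘ ℕP.*-monoʳ-≤ 2) ⇔-∘ <-via-toℕ (toℕ-left i) (toℕ-right j)

  right<left⇔ : ∀ {i j} → right i F.< left j ⇔ i F.< j
  right<left⇔ {i} {j} =
    mk⇔ (ℕP.*-cancelˡ-< 2 _ _ ∘ ℕP.<-trans (ℕP.n<1+n _))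
        (subst (ℕ._≤ 2 * toℕ j) (ℕP.*-suc 2 (toℕ i)) ∘ ℕP.*-monoʳ-≤ 2)
    ⇔-∘ <-via-toℕ (toℕ-right i) (toℕ-left j)

  interleave : ∀ {A : Set} → (Fin n → A) → (Fin n → A) → Fin (2 * n) → A
  interleave f g q = [ f ∘ proj₁ , g ∘ proj₁ ] (parity q)

  interleave-left : ∀ {A : Set} {f g : Fin n → A} i → interleave f g (left i) ≡ f i
  interleave-left {f = f} i with parity (left i)
  ... | inj₁ (i′ , e) = cong f (left-injective {i′} {i} (sym e))
  ... | inj₂ (i′ , e) = ⊥-elim (left≢right {i} {i′} e)

  interleave-right : ∀ {A : Set} {f g : Fin n → A} i → interleave f g (right i) ≡ g i
  interleave-right {g = g} i with parity (right i)
  ... | inj₁ (i′ , e) = ⊥-elim (left≢right {i′} {i} (sym e))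
  ... | inj₂ (i′ , e) = cong g (right-injective {i′} {i} (sym e))

  interleave-cong : ∀ {A : Set} {f f′ g g′ : Fin n → A} → f ≗ f′ → g ≗ g′ → interleave f g ≗ interleave f′ g′
  interleave-cong f≗f′ g≗g′ q with parity q
  ... | inj₁ (i , _) = f≗f′ i
  ... | inj₂ (i , _) = g≗g′ i

  OddPos-left : ∀ i → OddPos (left i)
  OddPos-left i = toℕ i , toℕ-left i

  EvenPos-right : ∀ i → EvenPos (right i)
  EvenPos-right i = toℕ i , trans (toℕ-right i) (ℕP.+-comm 1 _)

  ¬OddPos-right : ∀ i → ¬ OddPos (right i)
  ¬OddPos-right i (h , e) = ℕP.even≢odd h (toℕ i) (trans (sym e) (toℕ-right i))

  ¬EvenPos-left : ∀ i → ¬ EvenPos (left i)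
  ¬EvenPos-left i (h , e) = ℕP.even≢odd (toℕ i) h (trans (sym (toℕ-left i)) (trans e (ℕP.+-comm _ 1)))

  OddPos⇒left : ∀ {q} → OddPos q → ∃ λ (i : Fin n) → q ≡ left i
  OddPos⇒left {q} o with parity q
  ... | inj₁ q≡left = q≡left
  ... | inj₂ (i , refl) = ⊥-elim (¬OddPos-right i o)

  EvenPos⇒right : ∀ {q} → EvenPos q → ∃ λ (i : Fin n) → q ≡ right i
  EvenPos⇒right {q} e with parity q
  ... | inj₁ (i , refl) = ⊥-elim (¬EvenPos-left i e)
  ... | inj₂ q≡right = q≡right

  OddPos⇒¬EvenPos : ∀ {q} → OddPos q → ¬ EvenPos q
  OddPos⇒¬EvenPos o with OddPos⇒left o
  ... | i , refl = ¬EvenPos-left i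

module _ {n : ℕ} (σ : Permutation′ n) where

  ⟨$⟩ʳ-injective : ∀ {i j} → σ ⟨$⟩ʳ i ≡ σ ⟨$⟩ʳ j → i ≡ j
  ⟨$⟩ʳ-injective {i} {j} e = trans (sym (inverseˡ σ)) (trans (cong (σ ⟨$⟩ˡ_) e) (inverseˡ σ))

  ⟨$⟩ˡ-cong : ∀ {τ : Permutation′ n} → (∀ i → σ ⟨$⟩ʳ i ≡ τ ⟨$⟩ʳ i) → ∀ j → σ ⟨$⟩ˡ j ≡ τ ⟨$⟩ˡ j
  ⟨$⟩ˡ-cong {τ} σ≗τ j =
    ⟨$⟩ʳ-injective (trans (inverseʳ σ) (trans (sym (inverseʳ τ)) (sym (σ≗τ (τ ⟨$⟩ˡ j)))))

module _ {n : ℕ} {_∼_ : Fin n → Fin n → Set}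
  (image : ∀ i → ∃ (i ∼_)) (preimage : ∀ j → ∃ (_∼ j))
  (functional : ∀ {i j j′} → i ∼ j → i ∼ j′ → j ≡ j′)
  (injective : ∀ {i i′ j} → i ∼ j → i′ ∼ j → i ≡ i′) where

  fromBijectiveRelation : Permutation′ n
  fromBijectiveRelation = permutation (proj₁ ∘ image) (proj₁ ∘ preimage)
    (λ j → functional (proj₂ (image _)) (proj₂ (preimage j)))
    (λ i → injective (proj₂ (preimage _)) (proj₂ (image i)))

  fromBijectiveRelation-related : ∀ i → i ∼ (fromBijectiveRelation ⟨$⟩ʳ i)
  fromBijectiveRelation-related i = proj₂ (image i)

SameColours : ∀ {I C : Set} {P P′ : I → Set} → (∀ i → P i → C) → (∀ i → P′ i → C) → Set
SameColours ψ ψ′ = ∀ i p p′ → ψ i p ≡ ψ′ i p′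

SameColours-at : ∀ {I C : Set} {P P′ : I → Set} {ψ : ∀ i → P i → C} {ψ′ : ∀ i → P′ i → C} →
  SameColours ψ ψ′ → ∀ {i i′} → i ≡ i′ → ∀ p p′ → ψ i p ≡ ψ′ i′ p′
SameColours-at same refl = same _

IsDisjointUnion-resp : ∀ {m} {S A A′ B B′ : Fin m → Set} →
  (∀ x → A x ⇔ A′ x) → (∀ x → B x ⇔ B′ x) → IsDisjointUnion S A B → IsDisjointUnion S A′ B′
IsDisjointUnion-resp A⇔ B⇔ (cover , sound , disjoint) =
    (λ x → Sum.map (to (A⇔ x)) (to (B⇔ x)) ∘ cover x)
  , (λ x → sound x ∘ Sum.map (from (A⇔ x)) (from (B⇔ x)))
  , (λ x a b → disjoint x (from (A⇔ x) a) (from (B⇔ x) b))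

IsDisjointUnion-⇔ : ∀ {m} {S A A′ B B′ : Fin m → Set} →
  (∀ x → A x ⇔ A′ x) → (∀ x → B x ⇔ B′ x) → IsDisjointUnion S A B ⇔ IsDisjointUnion S A′ B′
IsDisjointUnion-⇔ A⇔ B⇔ =
  mk⇔ (IsDisjointUnion-resp A⇔ B⇔) (IsDisjointUnion-resp (⇔.sym ∘ A⇔) (⇔.sym ∘ B⇔))

Shape : Set₁
Shape = ∀ {k m} → (Fin m → Fin m → Set) → (Fin k → Fin m) → (Fin k → Fin m) → Set

module _ {m m′ : ℕ} {f : Fin m → Fin m′} (f-< : ∀ {u v} → f u F.< f v ⇔ u F.< v)
         {k : ℕ} {x : Fin k → Fin m} {x′ : Fin k → Fin m′} (x′≗ : x′ ≗ f ∘ x) where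

  Increasing-transport : Increasing x′ ⇔ Increasing x
  Increasing-transport = mk⇔
    (λ inc s t lt → to f-< (subst₂ F._<_ (x′≗ s) (x′≗ t) (inc s t lt)))
    (λ inc s t lt → subst₂ F._<_ (sym (x′≗ s)) (sym (x′≗ t)) (from f-< (inc s t lt)))

  Decreasing-transport : Decreasing x′ ⇔ Decreasing x
  Decreasing-transport = mk⇔
    (λ dec s t lt → to f-< (subst₂ F._<_ (x′≗ t) (x′≗ s) (dec s t lt)))
    (λ dec s t lt → subst₂ F._<_ (sym (x′≗ t)) (sym (x′≗ s)) (from f-< (dec s t lt)))

module _ {m m′ : ℕ} {f g : Fin m → Fin m′} {R : Fin m → Fin m → Set} {R′ : Fin m′ → Fin m′ → Set}
         (fg-R : ∀ {u v} → R′ (f u) (g v) ⇔ R u v)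
         {k : ℕ} {x y : Fin k → Fin m} {x′ y′ : Fin k → Fin m′} (x′≗ : x′ ≗ f ∘ x) (y′≗ : y′ ≗ g ∘ y) where

  Related-transport : (∀ s t → R′ (x′ s) (y′ t)) ⇔ (∀ s t → R (x s) (y t))
  Related-transport = mk⇔
    (λ rel s t → to fg-R (subst₂ R′ (x′≗ s) (y′≗ t) (rel s t)))
    (λ rel s t → subst₂ R′ (sym (x′≗ s)) (sym (y′≗ t)) (from fg-R (rel s t)))

record Transportable (Sh : Shape) : Set₁ where
  field
    transport : ∀ {m m′} {f g : Fin m → Fin m′} {R : Fin m → Fin m → Set} {R′ : Fin m′ → Fin m′ → Set} →
      (∀ {u v} → f u F.< f v ⇔ u F.< v) → (∀ {u v} → g u F.< g v ⇔ u F.< v) →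
      (∀ {u v} → R′ (f u) (g v) ⇔ R u v) →
      ∀ {k} {x y : Fin k → Fin m} {x′ y′ : Fin k → Fin m′} → x′ ≗ f ∘ x → y′ ≗ g ∘ y →
      Sh R′ x′ y′ ⇔ Sh R x y

open Transportable

CrossShape-transportable : Transportable CrossShape
transport CrossShape-transportable {f = f} {g} {R} {R′} f-< g-< fg-R x′≗ y′≗ =
     Increasing-transport f-< x′≗
  ×-⇔ Increasing-transport g-< y′≗
  ×-⇔ Related-transport {f = f} {g} {R} {R′} fg-R x′≗ y′≗

NestShape-transportable : Transportable NestShape
transport NestShape-transportable {f = f} {g} {R} {R′} f-< g-< fg-R x′≗ y′≗ =
     Increasing-transport f-< x′≗
  ×-⇔ Decreasing-transport g-< y′≗
  ×-⇔ Related-transport {f = f} {g} {R} {R′} fg-R x′≗ y′≗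

module _ {m r : ℕ} (L : ColMatching m r) where
  open ColMatching L

  Opener Closer : Fin m → Set
  Opener q = q F.< μ q
  Closer q = μ q F.< q

  min∖max⇔Opener : ∀ q → (InMin L ∖ InMax L) q ⇔ Opener q
  min∖max⇔Opener q = mk⇔ (ℕP.≰⇒> ∘ proj₂) (λ lt → ℕP.<⇒≤ lt , ℕP.<⇒≱ lt)

  max∖min⇔Closer : ∀ q → (InMax L ∖ InMin L) q ⇔ Closer q
  max∖min⇔Closer q = mk⇔ (ℕP.≰⇒> ∘ proj₂) (λ lt → ℕP.<⇒≤ lt , ℕP.<⇒≱ lt)

  partner-Closer : ∀ {q} → Opener q → Closer (μ q)
  partner-Closer {q} = subst (F._< μ q) (sym (invol q))

  partner-Opener : ∀ {q} → Closer q → Opener (μ q)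
  partner-Opener {q} = subst (μ q F.<_) (sym (invol q))

  μ-swap : ∀ {p q} → μ p ≡ q → μ q ≡ p
  μ-swap {p} e = trans (cong μ (sym e)) (invol p)

  μ-injective : ∀ {p q} → μ p ≡ μ q → p ≡ q
  μ-injective {p} {q} e = trans (sym (invol p)) (trans (cong μ e) (invol q))

  unmoved : ∀ {q} → ¬ Opener q → ¬ Closer q → μ q ≡ q
  unmoved {q} ¬open ¬close with FP.<-cmp q (μ q)
  ... | tri< lt _ _ = ⊥-elim (¬open lt)
  ... | tri≈ _ e _ = sym e
  ... | tri> _ _ gt = ⊥-elim (¬close gt)

  φ-cong : ∀ {p q} → p ≡ q → ∀ lt lt′ → φ p lt ≡ φ q lt′
  φ-cong = SameColours-at (λ q lt lt′ → cong (φ q) (FP.<-irrelevant lt lt′))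

  -- MonoArcs L CrossShape and MonoArcs L NestShape unfold to MHasCrossing L and MHasNesting L.
  MonoArcs : Shape → ℕ → Set
  MonoArcs Sh k = Σ (Fin k → Fin m) λ a → Σ ((t : Fin k) → a t F.< μ (a t)) λ p →
    (∃ λ c → ∀ t → φ (a t) (p t) ≡ c) × Sh F._<_ a (λ t → μ (a t))

module _ {m r : ℕ} (Λ⁺ Λ⁻ : ColMatching m r) where

  OddPos-split⇔ : IsDisjointUnion OddPos (InMin Λ⁺ ∖ InMax Λ⁺) (InMax Λ⁻ ∖ InMin Λ⁻)
                ⇔ IsDisjointUnion OddPos (Opener Λ⁺) (Closer Λ⁻)
  OddPos-split⇔ = IsDisjointUnion-⇔ (min∖max⇔Opener Λ⁺) (max∖min⇔Closer Λ⁻)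

  EvenPos-split⇔ : IsDisjointUnion EvenPos (InMax Λ⁺ ∖ InMin Λ⁺) (InMin Λ⁻ ∖ InMax Λ⁻)
                 ⇔ IsDisjointUnion EvenPos (Closer Λ⁺) (Opener Λ⁻)
  EvenPos-split⇔ = IsDisjointUnion-⇔ (max∖min⇔Closer Λ⁺) (min∖max⇔Opener Λ⁻)

module _ {n r : ℕ} (S : ColPerm n r) where
  open ColPerm S

  φ⁺-cong : ∀ {i i′} → i ≡ i′ → ∀ p p′ → φ⁺ i p ≡ φ⁺ i′ p′
  φ⁺-cong = SameColours-at (λ i p p′ → cong (φ⁺ i) (FP.≤-irrelevant p p′))

  φ⁻-cong : ∀ {i i′} → i ≡ i′ → ∀ p p′ → φ⁻ i p ≡ φ⁻ i′ p′
  φ⁻-cong = SameColours-at (λ i p p′ → cong (φ⁻ i) (FP.<-irrelevant p p′))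

  -- MonoArcs⁺ S CrossShape unfolds to HasCrossing⁺ S, and similarly for the other three.
  MonoArcs⁺ : Shape → ℕ → Set
  MonoArcs⁺ Sh k = Σ (Fin k → Fin n) λ a → Σ ((t : Fin k) → a t F.≤ σ ⟨$⟩ʳ a t) λ p →
    (∃ λ c → ∀ t → φ⁺ (a t) (p t) ≡ c) × Sh F._≤_ a (λ t → σ ⟨$⟩ʳ a t)

  MonoArcs⁻ : Shape → ℕ → Set
  MonoArcs⁻ Sh k = Σ (Fin k → Fin n) λ b → Σ ((t : Fin k) → σ ⟨$⟩ʳ b t F.< b t) λ p →
    (∃ λ c → ∀ t → φ⁻ (b t) (p t) ≡ c) × Sh F._<_ (λ t → σ ⟨$⟩ʳ b t) b

-- pair joins left i to right (σ i) exactly when R i (σ i); R = _≤_ gives Λ⁺ and R i j = j < i gives Λ⁻.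
module Pairing {n : ℕ} (σ : Permutation′ n) {R : Fin n → Fin n → Set} (R? : Decidable R) where

  partnerˡ partnerʳ : Fin n → Fin n → Fin (2 * n)
  partnerˡ i j = if does (R? i j) then right j else left i
  partnerʳ i j = if does (R? i j) then left i else right j

  pair : Fin (2 * n) → Fin (2 * n)
  pair = interleave (λ i → partnerˡ i (σ ⟨$⟩ʳ i)) (λ j → partnerʳ (σ ⟨$⟩ˡ j) j)

  module _ {i : Fin n} where

    linked-left : R i (σ ⟨$⟩ʳ i) → pair (left i) ≡ right (σ ⟨$⟩ʳ i)
    linked-left r =
      trans (interleave-left i) (cong (if_then right (σ ⟨$⟩ʳ i) else left i) (dec-true (R? _ _) r))

    unlinked-left : ¬ R i (σ ⟨$⟩ʳ i) → pair (left i) ≡ left i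
    unlinked-left ¬r =
      trans (interleave-left i) (cong (if_then right (σ ⟨$⟩ʳ i) else left i) (dec-false (R? _ _) ¬r))

    pair-right : pair (right (σ ⟨$⟩ʳ i)) ≡ partnerʳ i (σ ⟨$⟩ʳ i)
    pair-right = trans (interleave-right _) (cong (λ i′ → partnerʳ i′ (σ ⟨$⟩ʳ i)) (inverseˡ σ))

    linked-right : R i (σ ⟨$⟩ʳ i) → pair (right (σ ⟨$⟩ʳ i)) ≡ left i
    linked-right r = trans pair-right (cong (if_then left i else right (σ ⟨$⟩ʳ i)) (dec-true (R? _ _) r))

    unlinked-right : ¬ R i (σ ⟨$⟩ʳ i) → pair (right (σ ⟨$⟩ʳ i)) ≡ right (σ ⟨$⟩ʳ i)
    unlinked-right ¬r =
      trans pair-right (cong (if_then left i else right (σ ⟨$⟩ʳ i)) (dec-false (R? _ _) ¬r))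

  endpoint : ∀ q → ∃ λ i → q ≡ left i ⊎ q ≡ right (σ ⟨$⟩ʳ i)
  endpoint q with parity q
  ... | inj₁ (i , e) = i , inj₁ e
  ... | inj₂ (j , e) = σ ⟨$⟩ˡ j , inj₂ (trans e (cong right (sym (inverseʳ σ))))

  pair-involutive : ∀ q → pair (pair q) ≡ q
  pair-involutive q with endpoint q
  ... | i , inj₁ refl with R? i (σ ⟨$⟩ʳ i)
  ...   | yes r = trans (cong pair (linked-left r)) (linked-right r)
  ...   | no ¬r = trans (cong pair (unlinked-left ¬r)) (unlinked-left ¬r)
  pair-involutive q | i , inj₂ refl with R? i (σ ⟨$⟩ʳ i)
  ...   | yes r = trans (cong pair (linked-right r)) (linked-left r)
  ...   | no ¬r = trans (cong pair (unlinked-right ¬r)) (unlinked-right ¬r)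

  ArcThrough : Fin (2 * n) → Set
  ArcThrough q = Σ (Fin n) λ i → R i (σ ⟨$⟩ʳ i) ×
    (q ≡ left i × pair q ≡ right (σ ⟨$⟩ʳ i) ⊎ q ≡ right (σ ⟨$⟩ʳ i) × pair q ≡ left i)

  arcThrough : ∀ {q} → pair q ≢ q → ArcThrough q
  arcThrough {q} moved with endpoint q
  ... | i , inj₁ refl with R? i (σ ⟨$⟩ʳ i)
  ...   | yes r = i , r , inj₁ (refl , linked-left r)
  ...   | no ¬r = ⊥-elim (moved (unlinked-left ¬r))
  arcThrough {q} moved | i , inj₂ refl with R? i (σ ⟨$⟩ʳ i)
  ...   | yes r = i , r , inj₂ (refl , linked-right r)
  ...   | no ¬r = ⊥-elim (moved (unlinked-right ¬r))

  arcAt : ∀ {q} → q F.< pair q → ArcThrough q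
  arcAt lt = arcThrough (FP.<⇒≢ lt ∘ sym)

  arcIndex : ∀ {q} → q F.< pair q → Fin n
  arcIndex = proj₁ ∘ arcAt

  arcIndex-R : ∀ {q} (lt : q F.< pair q) → R (arcIndex lt) (σ ⟨$⟩ʳ arcIndex lt)
  arcIndex-R = proj₁ ∘ proj₂ ∘ arcAt

  matching : ∀ {r} → (∀ i → R i (σ ⟨$⟩ʳ i) → Fin r) → ColMatching (2 * n) r
  matching ψ = record
    { μ = pair
    ; invol = pair-involutive
    ; φ = λ q lt → ψ (arcIndex lt) (arcIndex-R lt)
    }

  module _ (R⇒left<right : ∀ {i j} → R i j → left i F.< right j) where

    opener-at-left : ∀ {q} (lt : q F.< pair q) →
      q ≡ left (arcIndex lt) × pair q ≡ right (σ ⟨$⟩ʳ arcIndex lt)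
    opener-at-left lt with proj₂ (proj₂ (arcAt lt))
    ... | inj₁ ends = ends
    ... | inj₂ (q≡ , pair-q≡) =
      ⊥-elim (FP.<-asym (subst₂ F._<_ q≡ pair-q≡ lt) (R⇒left<right (arcIndex-R lt)))

    closer-at-right : ∀ {q} → pair q F.< q → ∃ λ i → R i (σ ⟨$⟩ʳ i) × q ≡ right (σ ⟨$⟩ʳ i)
    closer-at-right {q} gt =
      arcIndex lt , arcIndex-R lt , trans (sym (pair-involutive q)) (proj₂ (opener-at-left lt))
      where lt = subst (pair q F.<_) (sym (pair-involutive q)) gt

  module _ (R⇒right<left : ∀ {i j} → R i j → right j F.< left i) where

    opener-at-right : ∀ {q} (lt : q F.< pair q) →
      q ≡ right (σ ⟨$⟩ʳ arcIndex lt) × pair q ≡ left (arcIndex lt)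
    opener-at-right lt with proj₂ (proj₂ (arcAt lt))
    ... | inj₁ (q≡ , pair-q≡) =
      ⊥-elim (FP.<-asym (subst₂ F._<_ q≡ pair-q≡ lt) (R⇒right<left (arcIndex-R lt)))
    ... | inj₂ ends = ends

    closer-at-left : ∀ {q} → pair q F.< q → ∃ λ i → R i (σ ⟨$⟩ʳ i) × q ≡ left i
    closer-at-left {q} gt =
      arcIndex lt , arcIndex-R lt , trans (sym (pair-involutive q)) (proj₂ (opener-at-right lt))
      where lt = subst (pair q F.<_) (sym (pair-involutive q)) gt

module _ {n : ℕ} {R : Fin n → Fin n → Set} (R? : Decidable R) {σ τ : Permutation′ n}
         (σ≗τ : ∀ i → σ ⟨$⟩ʳ i ≡ τ ⟨$⟩ʳ i) where
  private
    module Pσ = Pairing σ R?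
    module Pτ = Pairing τ R?

  pair-cong : Pσ.pair ≗ Pτ.pair
  pair-cong = interleave-cong (λ i → cong (Pσ.partnerˡ i) (σ≗τ i))
                              (λ j → cong (λ i → Pσ.partnerʳ i j) (⟨$⟩ˡ-cong σ {τ} σ≗τ j))

  arcIndex-cong : ∀ {q} (lt : q F.< Pσ.pair q) (lt′ : q F.< Pτ.pair q) → Pσ.arcIndex lt ≡ Pτ.arcIndex lt′
  arcIndex-cong lt lt′ with proj₂ (proj₂ (Pσ.arcAt lt)) | proj₂ (proj₂ (Pτ.arcAt lt′))
  ... | inj₁ (e , _) | inj₁ (e′ , _) = left-injective (trans (sym e) e′)
  ... | inj₁ (e , _) | inj₂ (e′ , _) = ⊥-elim (left≢right (trans (sym e) e′))
  ... | inj₂ (e , _) | inj₁ (e′ , _) = ⊥-elim (left≢right (trans (sym e′) e))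
  ... | inj₂ (e , _) | inj₂ (e′ , _) =
    ⟨$⟩ʳ-injective σ (trans (right-injective (trans (sym e) e′)) (sym (σ≗τ _)))

  matching-cong : ∀ {r} {ψ : ∀ i → R i (σ ⟨$⟩ʳ i) → Fin r} {ψ′ : ∀ i → R i (τ ⟨$⟩ʳ i) → Fin r} →
    SameColours ψ ψ′ → Pσ.matching ψ ≈CM Pτ.matching ψ′
  matching-cong same = pair-cong , λ q lt lt′ → SameColours-at same (arcIndex-cong lt lt′) _ _

module Linking {n r : ℕ} (Λ⁺ Λ⁻ : ColMatching (2 * n) r) where
  open ColMatching Λ⁺ using () renaming (μ to μ⁺)
  open ColMatching Λ⁻ using () renaming (μ to μ⁻)

  Linked : Fin n → Fin n → Set
  Linked i j = (μ⁺ (left i) ≡ right j × i F.≤ j) ⊎ (μ⁻ (left i) ≡ right j × j F.< i)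

  module _ {i j : Fin n} where

    linked⁺-opener : μ⁺ (left i) ≡ right j → i F.≤ j → Opener Λ⁺ (left i)
    linked⁺-opener e i≤j = subst (left i F.<_) (sym e) (from left<right⇔ i≤j)

    linked⁺-closer : μ⁺ (left i) ≡ right j → i F.≤ j → Closer Λ⁺ (right j)
    linked⁺-closer e i≤j = subst (F._< right j) (sym (μ-swap Λ⁺ e)) (from left<right⇔ i≤j)

    linked⁻-closer : μ⁻ (left i) ≡ right j → j F.< i → Closer Λ⁻ (left i)
    linked⁻-closer e j<i = subst (F._< left i) (sym e) (from right<left⇔ j<i)

    linked⁻-opener : μ⁻ (left i) ≡ right j → j F.< i → Opener Λ⁻ (right j)
    linked⁻-opener e j<i = subst (right j F.<_) (sym (μ-swap Λ⁻ e)) (from right<left⇔ j<i)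

    Linked⇒left-split : Linked i j → Opener Λ⁺ (left i) ⊎ Closer Λ⁻ (left i)
    Linked⇒left-split = Sum.map (λ (e , i≤j) → linked⁺-opener e i≤j) (λ (e , j<i) → linked⁻-closer e j<i)

    Linked⇒right-split : Linked i j → Closer Λ⁺ (right j) ⊎ Opener Λ⁻ (right j)
    Linked⇒right-split = Sum.map (λ (e , i≤j) → linked⁺-closer e i≤j) (λ (e , j<i) → linked⁻-opener e j<i)

    linked⁺ : Linked i j → i F.≤ j → μ⁺ (left i) ≡ right j
    linked⁺ (inj₁ (e , _)) _ = e
    linked⁺ (inj₂ (_ , j<i)) i≤j = ⊥-elim (ℕP.<⇒≱ j<i i≤j)

    linked⁻ : Linked i j → j F.< i → μ⁻ (left i) ≡ right j
    linked⁻ (inj₁ (_ , i≤j)) j<i = ⊥-elim (ℕP.<⇒≱ j<i i≤j)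
    linked⁻ (inj₂ (e , _)) _ = e

module Forward {n r : ℕ} (S : ColPerm n r) where
  open ColPerm S

  module P⁺ = Pairing σ {R = F._≤_} F._≤?_
  module P⁻ = Pairing σ {R = λ i j → j F.< i} (λ i j → j F.<? i)

  Λ⁺ Λ⁻ : ColMatching (2 * n) r
  Λ⁺ = P⁺.matching φ⁺
  Λ⁻ = P⁻.matching φ⁻

  open Linking {n} Λ⁺ Λ⁻

  opener⁺ : ∀ {q} (lt : Opener Λ⁺ q) → q ≡ left (P⁺.arcIndex lt) × P⁺.pair q ≡ right (σ ⟨$⟩ʳ P⁺.arcIndex lt)
  opener⁺ = P⁺.opener-at-left (from left<right⇔)

  closer⁺ : ∀ {q} → Closer Λ⁺ q → ∃ λ i → i F.≤ σ ⟨$⟩ʳ i × q ≡ right (σ ⟨$⟩ʳ i)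
  closer⁺ = P⁺.closer-at-right (from left<right⇔)

  opener⁻ : ∀ {q} (lt : Opener Λ⁻ q) → q ≡ right (σ ⟨$⟩ʳ P⁻.arcIndex lt) × P⁻.pair q ≡ left (P⁻.arcIndex lt)
  opener⁻ = P⁻.opener-at-right (from right<left⇔)

  closer⁻ : ∀ {q} → Closer Λ⁻ q → ∃ λ i → σ ⟨$⟩ʳ i F.< i × q ≡ left i
  closer⁻ = P⁻.closer-at-left (from right<left⇔)

  toMonoArcs⁺ : ∀ {Sh : Shape} {k} → Transportable Sh → MonoArcs Λ⁺ Sh k → MonoArcs⁺ S Sh k
  toMonoArcs⁺ T (a , p , colour , shape) =
      P⁺.arcIndex ∘ p , P⁺.arcIndex-R ∘ p , colour
    , to (transport T left<left⇔ right<right⇔ left<right⇔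
                    (λ t → proj₁ (opener⁺ (p t))) (λ t → proj₂ (opener⁺ (p t)))) shape

  toMonoArcs⁻ : ∀ {Sh : Shape} {k} → Transportable Sh → MonoArcs Λ⁻ Sh k → MonoArcs⁻ S Sh k
  toMonoArcs⁻ T (a , p , colour , shape) =
      P⁻.arcIndex ∘ p , P⁻.arcIndex-R ∘ p , colour
    , to (transport T right<right⇔ left<left⇔ right<left⇔
                    (λ t → proj₁ (opener⁻ (p t))) (λ t → proj₂ (opener⁻ (p t)))) shape

  σ-linked : ∀ i → Linked i (σ ⟨$⟩ʳ i)
  σ-linked i with i F.≤? σ ⟨$⟩ʳ i
  ... | yes i≤σi = inj₁ (P⁺.linked-left i≤σi , i≤σi)
  ... | no i≰σi = inj₂ (P⁻.linked-left (ℕP.≰⇒> i≰σi) , ℕP.≰⇒> i≰σi)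

  private
    clash : ∀ {i i′} → i F.≤ σ ⟨$⟩ʳ i → σ ⟨$⟩ʳ i′ F.< i′ → i ≢ i′
    clash i≤σi σi<i refl = ℕP.<⇒≱ σi<i i≤σi

  odd-split : IsDisjointUnion OddPos (Opener Λ⁺) (Closer Λ⁻)
  odd-split = cover , sound , disjoint
    where
    cover : ∀ q → OddPos q → Opener Λ⁺ q ⊎ Closer Λ⁻ q
    cover q odd with P⁺.endpoint q
    ... | i , inj₁ refl = Linked⇒left-split (σ-linked i)
    ... | i , inj₂ refl = ⊥-elim (¬OddPos-right _ odd)
    sound : ∀ q → Opener Λ⁺ q ⊎ Closer Λ⁻ q → OddPos q
    sound q (inj₁ lt) = subst OddPos (sym (proj₁ (opener⁺ lt))) (OddPos-left _)
    sound q (inj₂ gt) = subst OddPos (sym (proj₂ (proj₂ (closer⁻ gt)))) (OddPos-left _)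
    disjoint : ∀ q → Opener Λ⁺ q → Closer Λ⁻ q → ⊥
    disjoint q lt gt with closer⁻ gt
    ... | i , σi<i , q≡left-i =
      clash (P⁺.arcIndex-R lt) σi<i (left-injective (trans (sym (proj₁ (opener⁺ lt))) q≡left-i))

  even-split : IsDisjointUnion EvenPos (Closer Λ⁺) (Opener Λ⁻)
  even-split = cover , sound , disjoint
    where
    cover : ∀ q → EvenPos q → Closer Λ⁺ q ⊎ Opener Λ⁻ q
    cover q even with P⁺.endpoint q
    ... | i , inj₁ refl = ⊥-elim (¬EvenPos-left _ even)
    ... | i , inj₂ refl = Linked⇒right-split (σ-linked i)
    sound : ∀ q → Closer Λ⁺ q ⊎ Opener Λ⁻ q → EvenPos q
    sound q (inj₁ gt) = subst EvenPos (sym (proj₂ (proj₂ (closer⁺ gt)))) (EvenPos-right _)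
    sound q (inj₂ lt) = subst EvenPos (sym (proj₁ (opener⁻ lt))) (EvenPos-right _)
    disjoint : ∀ q → Closer Λ⁺ q → Opener Λ⁻ q → ⊥
    disjoint q gt lt with closer⁺ gt
    ... | i , i≤σi , q≡right-σi =
      clash i≤σi (P⁻.arcIndex-R lt)
        (⟨$⟩ʳ-injective σ (right-injective (trans (sym q≡right-σi) (proj₁ (opener⁻ lt)))))

module Backward {n r : ℕ} (Λ⁺ Λ⁻ : ColMatching (2 * n) r)
  (odd-split : IsDisjointUnion OddPos (Opener Λ⁺) (Closer Λ⁻))
  (even-split : IsDisjointUnion EvenPos (Closer Λ⁺) (Opener Λ⁻)) where
  open ColMatching Λ⁺ using () renaming (μ to μ⁺; φ to φ⁺)
  open ColMatching Λ⁻ using () renaming (μ to μ⁻; φ to φ⁻)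
  open Linking {n} Λ⁺ Λ⁻

  private
    odd-sound : ∀ {q} → Opener Λ⁺ q ⊎ Closer Λ⁻ q → OddPos q
    odd-sound = proj₁ (proj₂ odd-split) _

    even-sound : ∀ {q} → Closer Λ⁺ q ⊎ Opener Λ⁻ q → EvenPos q
    even-sound = proj₁ (proj₂ even-split) _

  opener⁺-left : ∀ {q} → Opener Λ⁺ q → ∃ λ (i : Fin n) → q ≡ left i
  opener⁺-left = OddPos⇒left ∘ odd-sound ∘ inj₁

  closer⁻-left : ∀ {q} → Closer Λ⁻ q → ∃ λ (i : Fin n) → q ≡ left i
  closer⁻-left = OddPos⇒left ∘ odd-sound ∘ inj₂

  closer⁺-right : ∀ {q} → Closer Λ⁺ q → ∃ λ (j : Fin n) → q ≡ right j
  closer⁺-right = EvenPos⇒right ∘ even-sound ∘ inj₁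

  opener⁻-right : ∀ {q} → Opener Λ⁻ q → ∃ λ (j : Fin n) → q ≡ right j
  opener⁻-right = EvenPos⇒right ∘ even-sound ∘ inj₂

  private
    odd-disjoint : ∀ {q} → Opener Λ⁺ q → Closer Λ⁻ q → ⊥
    odd-disjoint = proj₂ (proj₂ odd-split) _

    even-disjoint : ∀ {q} → Closer Λ⁺ q → Opener Λ⁻ q → ⊥
    even-disjoint = proj₂ (proj₂ even-split) _

    odd∧even : ∀ {q} → Opener Λ⁺ q ⊎ Closer Λ⁻ q → Closer Λ⁺ q ⊎ Opener Λ⁻ q → ⊥
    odd∧even odd even = OddPos⇒¬EvenPos {n} (odd-sound odd) (even-sound even)

  -- By (a) and (b) every position is moved by exactly one of Λ⁺ and Λ⁻.
  opener⁺⇒fixed⁻ : ∀ {q} → Opener Λ⁺ q → μ⁻ q ≡ q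
  opener⁺⇒fixed⁻ lt = unmoved Λ⁻ (odd∧even (inj₁ lt) ∘ inj₂) (odd-disjoint lt)

  closer⁺⇒fixed⁻ : ∀ {q} → Closer Λ⁺ q → μ⁻ q ≡ q
  closer⁺⇒fixed⁻ gt = unmoved Λ⁻ (even-disjoint gt) (flip odd∧even (inj₁ gt) ∘ inj₂)

  opener⁻⇒fixed⁺ : ∀ {q} → Opener Λ⁻ q → μ⁺ q ≡ q
  opener⁻⇒fixed⁺ lt = unmoved Λ⁺ (flip odd∧even (inj₂ lt) ∘ inj₁) (flip even-disjoint lt)

  closer⁻⇒fixed⁺ : ∀ {q} → Closer Λ⁻ q → μ⁺ q ≡ q
  closer⁻⇒fixed⁺ gt = unmoved Λ⁺ (flip odd-disjoint gt) (odd∧even (inj₂ gt) ∘ inj₁)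

  linked-image : ∀ (i : Fin n) → ∃ (Linked i)
  linked-image i with proj₁ odd-split (left i) (OddPos-left i)
  ... | inj₁ lt with closer⁺-right (partner-Closer Λ⁺ lt)
  ...   | j , e = j , inj₁ (e , to left<right⇔ (subst (left i F.<_) e lt))
  linked-image i | inj₂ gt with opener⁻-right (partner-Opener Λ⁻ gt)
  ...   | j , e = j , inj₂ (e , to right<left⇔ (subst (F._< left i) e gt))

  linked-preimage : ∀ (j : Fin n) → ∃ λ i → Linked i j
  linked-preimage j with proj₁ even-split (right j) (EvenPos-right j)
  ... | inj₁ gt with opener⁺-left (partner-Opener Λ⁺ gt)
  ...   | i , e = i , inj₁ (μ-swap Λ⁺ e , to left<right⇔ (subst (F._< right j) e gt))
  linked-preimage j | inj₂ lt with closer⁻-left (partner-Closer Λ⁻ lt)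
  ...   | i , e = i , inj₂ (μ-swap Λ⁻ e , to right<left⇔ (subst (right j F.<_) e lt))

  linked-functional : ∀ {i j j′} → Linked i j → Linked i j′ → j ≡ j′
  linked-functional (inj₁ (e , _)) (inj₁ (e′ , _)) = right-injective (trans (sym e) e′)
  linked-functional (inj₂ (e , _)) (inj₂ (e′ , _)) = right-injective (trans (sym e) e′)
  linked-functional (inj₁ (e , i≤j)) (inj₂ (e′ , j′<i)) =
    ⊥-elim (odd-disjoint (linked⁺-opener e i≤j) (linked⁻-closer e′ j′<i))
  linked-functional (inj₂ (e , j<i)) (inj₁ (e′ , i≤j′)) =
    ⊥-elim (odd-disjoint (linked⁺-opener e′ i≤j′) (linked⁻-closer e j<i))

  linked-injective : ∀ {i i′ j} → Linked i j → Linked i′ j → i ≡ i′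
  linked-injective (inj₁ (e , _)) (inj₁ (e′ , _)) = left-injective (μ-injective Λ⁺ (trans e (sym e′)))
  linked-injective (inj₂ (e , _)) (inj₂ (e′ , _)) = left-injective (μ-injective Λ⁻ (trans e (sym e′)))
  linked-injective (inj₁ (e , i≤j)) (inj₂ (e′ , j<i′)) =
    ⊥-elim (even-disjoint (linked⁺-closer e i≤j) (linked⁻-opener e′ j<i′))
  linked-injective (inj₂ (e , j<i)) (inj₁ (e′ , i′≤j)) =
    ⊥-elim (even-disjoint (linked⁺-closer e′ i′≤j) (linked⁻-opener e j<i))

  σ : Permutation′ n
  σ = fromBijectiveRelation linked-image linked-preimage linked-functional linked-injective

  σ-linked : ∀ i → Linked i (σ ⟨$⟩ʳ i)
  σ-linked = fromBijectiveRelation-related linked-image linked-preimage linked-functional linked-injective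

  opener-at-left : ∀ {i} → i F.≤ σ ⟨$⟩ʳ i → Opener Λ⁺ (left i)
  opener-at-left {i} p = linked⁺-opener (linked⁺ (σ-linked i) p) p

  opener-at-right : ∀ {i} → σ ⟨$⟩ʳ i F.< i → Opener Λ⁻ (right (σ ⟨$⟩ʳ i))
  opener-at-right {i} p = linked⁻-opener (linked⁻ (σ-linked i) p) p

  colPerm : ColPerm n r
  colPerm = record
    { σ = σ
    ; φ⁺ = λ i p → φ⁺ (left i) (opener-at-left p)
    ; φ⁻ = λ i p → φ⁻ (right (σ ⟨$⟩ʳ i)) (opener-at-right p)
    }

  fromMonoArcs⁺ : ∀ {Sh : Shape} {k} → Transportable Sh → MonoArcs⁺ colPerm Sh k → MonoArcs Λ⁺ Sh k
  fromMonoArcs⁺ T (a , p , colour , shape) =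
      left ∘ a , opener-at-left ∘ p , colour
    , from (transport T left<left⇔ right<right⇔ left<right⇔
                      (λ _ → refl) (λ t → linked⁺ (σ-linked (a t)) (p t))) shape

  fromMonoArcs⁻ : ∀ {Sh : Shape} {k} → Transportable Sh → MonoArcs⁻ colPerm Sh k → MonoArcs Λ⁻ Sh k
  fromMonoArcs⁻ T (b , p , colour , shape) =
      (λ t → right (σ ⟨$⟩ʳ b t)) , opener-at-right ∘ p , colour
    , from (transport T right<right⇔ left<left⇔ right<left⇔
                      (λ _ → refl) (λ t → μ-swap Λ⁻ (linked⁻ (σ-linked (b t)) (p t)))) shape

module _ {n r : ℕ} (S : ColPerm n r) where
  open ColPerm S
  open Forward S hiding (odd-split; even-split)

  -- Stated for any proofs of (a) and (b): fromMatchings ∘ toMatchings rebuilds them via the split⇔ lemmas.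
  module _ (odd-split : IsDisjointUnion OddPos (Opener Λ⁺) (Closer Λ⁻))
           (even-split : IsDisjointUnion EvenPos (Closer Λ⁺) (Opener Λ⁻)) where
    private module B = Backward {n} Λ⁺ Λ⁻ odd-split even-split

    σ-recovered : ∀ i → B.σ ⟨$⟩ʳ i ≡ σ ⟨$⟩ʳ i
    σ-recovered i = B.linked-functional (B.σ-linked i) (σ-linked i)

    backward∘forward : B.colPerm ≈CP S
    backward∘forward =
        σ-recovered
      , (λ i p p′ → φ⁺-cong S (sym (left-injective (proj₁ (opener⁺ (B.opener-at-left p))))) _ p′)
      , (λ i p p′ → φ⁻-cong S (⟨$⟩ʳ-injective σ
          (trans (sym (right-injective (proj₁ (opener⁻ (B.opener-at-right p))))) (σ-recovered i))) _ p′)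

module _ {n r : ℕ} (Λ⁺ Λ⁻ : ColMatching (2 * n) r)
  (odd-split : IsDisjointUnion OddPos (Opener Λ⁺) (Closer Λ⁻))
  (even-split : IsDisjointUnion EvenPos (Closer Λ⁺) (Opener Λ⁻)) where
  open Backward {n} Λ⁺ Λ⁻ odd-split even-split
  open Linking {n} Λ⁺ Λ⁻
  private module Fw = Forward colPerm
  open ColMatching Λ⁺ using () renaming (μ to μ⁺)
  open ColMatching Λ⁻ using () renaming (μ to μ⁻)

  μ⁺-recovered : ∀ q → Fw.P⁺.pair q ≡ μ⁺ q
  μ⁺-recovered q with Fw.P⁺.endpoint q
  ... | i , inj₁ refl with σ-linked i
  ...   | inj₁ (e , i≤σi) = trans (Fw.P⁺.linked-left i≤σi) (sym e)
  ...   | inj₂ (e , σi<i) = trans (Fw.P⁺.unlinked-left (ℕP.<⇒≱ σi<i))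
                                  (sym (closer⁻⇒fixed⁺ (linked⁻-closer e σi<i)))
  μ⁺-recovered q | i , inj₂ refl with σ-linked i
  ...   | inj₁ (e , i≤σi) = trans (Fw.P⁺.linked-right i≤σi) (sym (μ-swap Λ⁺ e))
  ...   | inj₂ (e , σi<i) = trans (Fw.P⁺.unlinked-right (ℕP.<⇒≱ σi<i))
                                  (sym (opener⁻⇒fixed⁺ (linked⁻-opener e σi<i)))

  μ⁻-recovered : ∀ q → Fw.P⁻.pair q ≡ μ⁻ q
  μ⁻-recovered q with Fw.P⁻.endpoint q
  ... | i , inj₁ refl with σ-linked i
  ...   | inj₁ (e , i≤σi) = trans (Fw.P⁻.unlinked-left (ℕP.≤⇒≯ i≤σi))
                                  (sym (opener⁺⇒fixed⁻ (linked⁺-opener e i≤σi)))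
  ...   | inj₂ (e , σi<i) = trans (Fw.P⁻.linked-left σi<i) (sym e)
  μ⁻-recovered q | i , inj₂ refl with σ-linked i
  ...   | inj₁ (e , i≤σi) = trans (Fw.P⁻.unlinked-right (ℕP.≤⇒≯ i≤σi))
                                  (sym (closer⁺⇒fixed⁻ (linked⁺-closer e i≤σi)))
  ...   | inj₂ (e , σi<i) = trans (Fw.P⁻.linked-right σi<i) (sym (μ-swap Λ⁻ e))

  forward∘backward : (Fw.Λ⁺ ≈CM Λ⁺) × (Fw.Λ⁻ ≈CM Λ⁻)
  forward∘backward =
      (μ⁺-recovered , λ q lt lt′ → φ-cong Λ⁺ (sym (proj₁ (Fw.opener⁺ lt))) _ lt′)
    , (μ⁻-recovered , λ q lt lt′ → φ-cong Λ⁻ (sym (proj₁ (Fw.opener⁻ lt))) _ lt′)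

forward-cong : ∀ {n r} {S S′ : ColPerm n r} → S ≈CP S′ →
  (Forward.Λ⁺ S ≈CM Forward.Λ⁺ S′) × (Forward.Λ⁻ S ≈CM Forward.Λ⁻ S′)
forward-cong (σ≗ , same⁺ , same⁻) = matching-cong F._≤?_ σ≗ same⁺ , matching-cong (λ i j → j F.<? i) σ≗ same⁻

backward-cong : ∀ {n r} {Λ⁺ Λ⁻ Λ′⁺ Λ′⁻ : ColMatching (2 * n) r}
  {odd : IsDisjointUnion OddPos (Opener Λ⁺) (Closer Λ⁻)} {even : IsDisjointUnion EvenPos (Closer Λ⁺) (Opener Λ⁻)}
  {odd′ : IsDisjointUnion OddPos (Opener Λ′⁺) (Closer Λ′⁻)} {even′ : IsDisjointUnion EvenPos (Closer Λ′⁺) (Opener Λ′⁻)} →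
  Λ⁺ ≈CM Λ′⁺ → Λ⁻ ≈CM Λ′⁻ → Backward.colPerm {n} Λ⁺ Λ⁻ odd even ≈CP Backward.colPerm {n} Λ′⁺ Λ′⁻ odd′ even′
backward-cong {n} {_} {Λ⁺} {Λ⁻} {Λ′⁺} {Λ′⁻} {odd} {even} {odd′} {even′} (μ⁺≗ , same⁺) (μ⁻≗ , same⁻) =
  σ≗ , (λ i _ _ → same⁺ (left i) _ _) , (λ i _ _ → SameColours-at same⁻ (cong right (σ≗ i)) _ _)
  where
  module B = Backward {n} Λ⁺ Λ⁻ odd even
  module B′ = Backward {n} Λ′⁺ Λ′⁻ odd′ even′
  linked-resp : ∀ {i j} → Linking.Linked {n} Λ⁺ Λ⁻ i j → Linking.Linked {n} Λ′⁺ Λ′⁻ i j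
  linked-resp = Sum.map (Product.map₁ (trans (sym (μ⁺≗ _)))) (Product.map₁ (trans (sym (μ⁻≗ _))))
  σ≗ : ∀ i → B.σ ⟨$⟩ʳ i ≡ B′.σ ⟨$⟩ʳ i
  σ≗ i = B′.linked-functional (linked-resp (B.σ-linked i)) (B′.σ-linked i)

module _ {j k n r : ℕ} where
  private
    module CP = Setoid (CPSetoid {n} {r} j k)
    module MP = Setoid (MPSetoid {n} {r} j k)

  toMatchings : CPSet j k n r → MPSet j k n r
  toMatchings (S , cr<j , ne<k) =
      (Λ⁺ , Λ⁻)
    , ( (λ k′ → cr<j k′ ∘ inj₁ ∘ toMonoArcs⁺ CrossShape-transportable)
      , (λ k′ → ne<k k′ ∘ inj₁ ∘ toMonoArcs⁺ NestShape-transportable))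
    , ( (λ k′ → cr<j k′ ∘ inj₂ ∘ toMonoArcs⁻ CrossShape-transportable)
      , (λ k′ → ne<k k′ ∘ inj₂ ∘ toMonoArcs⁻ NestShape-transportable))
    , from (OddPos-split⇔ Λ⁺ Λ⁻) odd-split
    , from (EvenPos-split⇔ Λ⁺ Λ⁻) even-split
    where open Forward S

  fromMatchings : MPSet j k n r → CPSet j k n r
  fromMatchings ((Λ⁺ , Λ⁻) , (cr⁺<j , ne⁺<k) , (cr⁻<j , ne⁻<k) , odd , even) =
      colPerm
    , (λ k′ → [ cr⁺<j k′ ∘ fromMonoArcs⁺ CrossShape-transportable
              , cr⁻<j k′ ∘ fromMonoArcs⁻ CrossShape-transportable ])
    , (λ k′ → [ ne⁺<k k′ ∘ fromMonoArcs⁺ NestShape-transportable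
              , ne⁻<k k′ ∘ fromMonoArcs⁻ NestShape-transportable ])
    where open Backward {n} Λ⁺ Λ⁻ (to (OddPos-split⇔ Λ⁺ Λ⁻) odd) (to (EvenPos-split⇔ Λ⁺ Λ⁻) even)

  fromMatchings∘toMatchings : ∀ x → fromMatchings (toMatchings x) CP.≈ x
  fromMatchings∘toMatchings (S , _) =
    backward∘forward S (to (OddPos-split⇔ Λ⁺ Λ⁻) (from (OddPos-split⇔ Λ⁺ Λ⁻) odd-split))
                       (to (EvenPos-split⇔ Λ⁺ Λ⁻) (from (EvenPos-split⇔ Λ⁺ Λ⁻) even-split))
    where open Forward S

  toMatchings∘fromMatchings : ∀ y → toMatchings (fromMatchings y) MP.≈ y
  toMatchings∘fromMatchings ((Λ⁺ , Λ⁻) , _ , _ , odd , even) =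
    forward∘backward {n} Λ⁺ Λ⁻ (to (OddPos-split⇔ Λ⁺ Λ⁻) odd) (to (EvenPos-split⇔ Λ⁺ Λ⁻) even)

  toMatchings-cong : ∀ {x y} → x CP.≈ y → toMatchings x MP.≈ toMatchings y
  toMatchings-cong {S , _} {S′ , _} = forward-cong {S = S} {S′}

  fromMatchings-cong : ∀ {x y} → x MP.≈ y → fromMatchings x CP.≈ fromMatchings y
  fromMatchings-cong {(Λ⁺ , Λ⁻) , _ , _ , odd , even} {(Λ′⁺ , Λ′⁻) , _ , _ , odd′ , even′} (≈⁺ , ≈⁻) =
    backward-cong {n} {odd = to (OddPos-split⇔ Λ⁺ Λ⁻) odd} {to (EvenPos-split⇔ Λ⁺ Λ⁻) even}
                      {to (OddPos-split⇔ Λ′⁺ Λ′⁻) odd′} {to (EvenPos-split⇔ Λ′⁺ Λ′⁻) even′} ≈⁺ ≈⁻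

  correspondence : Inverse (CPSetoid {n} {r} j k) (MPSetoid {n} {r} j k)
  correspondence = record
    { to = toMatchings
    ; from = fromMatchings
    ; to-cong = λ {x} {y} → toMatchings-cong {x} {y}
    ; from-cong = λ {x} {y} → fromMatchings-cong {x} {y}
    ; inverse =
        (λ {y} {x} x≈ → MP.trans {toMatchings x} {toMatchings (fromMatchings y)} {y}
                           (toMatchings-cong {x} {fromMatchings y} x≈) (toMatchings∘fromMatchings y))
      , (λ {x} {y} y≈ → CP.trans {fromMatchings y} {fromMatchings (toMatchings x)} {x}
                           (fromMatchings-cong {y} {toMatchings x} y≈) (fromMatchings∘toMatchings x))
    }

proposition5p12 : (j k n r : ℕ) → 0 < j → 0 < k → 0 < n → 0 < r →
    Bijection (CPSetoid {n} {r} j k) (MPSetoid {n} {r} j k)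
proposition5p12 j k n r _ _ _ _ = Inverse⇒Bijection correspondence
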